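{- Let $G_{2,4}$ be a regular $2$-balanced $4$-partite tournament with partite sets $V_{i} = \{v_{i,1}, v_{i,2}\}, i\in [4]$. If every two partite sets are related by control-1 (in one direction), then $G_{2,4}$ is isomorphic to $G_1$ or $G_2$, where $G_1$ has arc set $v_{1,1}\to v_{2,1},v_{3,2},v_{4,1}$; $v_{1,2}\to v_{2,2},v_{3,1},v_{4,2}$; $v_{2,1}\to v_{1,2},v_{3,1},v_{4,1}$; $v_{2,2}\to v_{1,1},v_{3,2},v_{4,2}$; $v_{3,1}\to v_{1,1},v_{2,2},v_{4,1}$; $v_{3,2}\to v_{1,2},v_{2,1},v_{4,2}$; $v_{4,1}\to v_{1,2},v_{2,2},v_{3,2}$; $v_{4,2}\to v_{1,1},v_{2,1},v_{3,1}$, and $G_2$ has arc set $v_{1,1}\to v_{2,1},v_{3,1},v_{4,1}$; $v_{1,2}\to v_{2,2},v_{3,2},v_{4,2}$; $v_{2,1}\to v_{1,2},v_{3,2},v_{4,2}$; $v_{2,2}\to v_{1,1},v_{3,1},v_{4,1}$; $v_{3,1}\to v_{1,2},v_{2,1},v_{4,2}$; $v_{3,2}\to v_{1,1},v_{2,2},v_{4,1}$; $v_{4,1}\to v_{1,2},v_{2,1},v_{3,1}$; $v_{4,2}\to v_{1,1},v_{2,2},v_{3,2}$.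
   Context: $G_{2,4}$ is an orientation of the complete $4$-partite graph with all partite sets of size $2$, regular meaning $d^+(v)=d^-(v)$ for all vertices. For distinct partite sets, $V_i$ controls-1 $V_j$ if there are exactly two arcs from $V_i$ to $V_j$ and $|N^{+}(v_{i,1}) \cap V_j| = |N^{+}(v_{i,2}) \cap V_j| = |N^{+}(v_{j,1}) \cap V_i| = |N^{+}(v_{j,2}) \cap V_i| = 1$ (the four arcs between $V_i$ and $V_j$ form a directed $4$-cycle). -}

module Defs where

open import Data.Bool using (Bool; true; false; not; _∨_; if_then_else_)
open import Data.Nat using (ℕ; _+_)
open import Data.Fin using (Fin; zero; suc; _≟_)
open import Data.Product using (_×_; _,_; proj₁; proj₂; Σ)
open import Data.List using (List; []; _∷_; map; allFin; cartesianProduct)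
open import Data.Nat.ListAction using (sum)
open import Data.Bool.ListAction using (any)
open import Relation.Nullary.Decidable using (⌊_⌋)
open import Relation.Binary.PropositionalEquality using (_≡_; _≢_)

-- Vertex v_{i,k} is encoded as (i-1 , k-1) : Fin 4 × Fin 2; partite set V_i = { (i-1,0), (i-1,1) }.
V : Set
V = Fin 4 × Fin 2

part : V → Fin 4
part = proj₁

Digraph : Set
Digraph = V → V → Bool

vertices : List V
vertices = cartesianProduct (allFin 4) (allFin 2)

count : List V → (V → Bool) → ℕ
count xs p = sum (map (λ x → if p x then 1 else 0) xs)

outdeg indeg : Digraph → V → ℕ
outdeg A v = count vertices (λ w → A v w)
indeg  A v = count vertices (λ w → A w v)

partSet : Fin 4 → List V
partSet j = map (λ k → (j , k)) (allFin 2)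

IsMultipartiteTournament : Digraph → Set
IsMultipartiteTournament A =
  (∀ u v → part u ≡ part v → A u v ≡ false) ×
  (∀ u v → part u ≢ part v → A u v ≡ not (A v u))

IsRegular : Digraph → Set
IsRegular A = ∀ v → outdeg A v ≡ indeg A v

outInto : Digraph → V → Fin 4 → ℕ
outInto A v j = count (partSet j) (λ w → A v w)

arcsFromTo : Digraph → Fin 4 → Fin 4 → ℕ
arcsFromTo A i j = sum (map (λ v → outInto A v j) (partSet i))

Controls1 : Digraph → Fin 4 → Fin 4 → Set
Controls1 A i j =
  arcsFromTo A i j ≡ 2 ×
  outInto A (i , zero) j ≡ 1 × outInto A (i , suc zero) j ≡ 1 ×
  outInto A (j , zero) i ≡ 1 × outInto A (j , suc zero) i ≡ 1

_==_ : V → V → Bool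
(i , k) == (j , l) = ⌊ i ≟ j ⌋ Data.Bool.∧ ⌊ k ≟ l ⌋
  where import Data.Bool

fromOut : (V → List V) → Digraph
fromOut out u v = any (λ w → w == v) (out u)

v11 : V
v11 = (zero , zero)
v12 : V
v12 = (zero , suc zero)
v21 : V
v21 = (suc zero , zero)
v22 : V
v22 = (suc zero , suc zero)
v31 : V
v31 = (suc (suc zero) , zero)
v32 : V
v32 = (suc (suc zero) , suc zero)
v41 : V
v41 = (suc (suc (suc zero)) , zero)
v42 : V
v42 = (suc (suc (suc zero)) , suc zero)

outG1 : V → List V
outG1 (zero , zero) = v21 ∷ v32 ∷ v41 ∷ []
outG1 (zero , suc zero) = v22 ∷ v31 ∷ v42 ∷ []
outG1 (suc zero , zero) = v12 ∷ v31 ∷ v41 ∷ []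
outG1 (suc zero , suc zero) = v11 ∷ v32 ∷ v42 ∷ []
outG1 (suc (suc zero) , zero) = v11 ∷ v22 ∷ v41 ∷ []
outG1 (suc (suc zero) , suc zero) = v12 ∷ v21 ∷ v42 ∷ []
outG1 (suc (suc (suc zero)) , zero) = v12 ∷ v22 ∷ v32 ∷ []
outG1 (suc (suc (suc zero)) , suc zero) = v11 ∷ v21 ∷ v31 ∷ []

G1 : Digraph
G1 = fromOut outG1

outG2 : V → List V
outG2 (zero , zero) = v21 ∷ v31 ∷ v41 ∷ []
outG2 (zero , suc zero) = v22 ∷ v32 ∷ v42 ∷ []
outG2 (suc zero , zero) = v12 ∷ v32 ∷ v42 ∷ []
outG2 (suc zero , suc zero) = v11 ∷ v31 ∷ v41 ∷ []
outG2 (suc (suc zero) , zero) = v12 ∷ v21 ∷ v42 ∷ []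
outG2 (suc (suc zero) , suc zero) = v11 ∷ v22 ∷ v41 ∷ []
outG2 (suc (suc (suc zero)) , zero) = v12 ∷ v21 ∷ v31 ∷ []
outG2 (suc (suc (suc zero)) , suc zero) = v11 ∷ v22 ∷ v32 ∷ []

G2 : Digraph
G2 = fromOut outG2

Isomorphic : Digraph → Digraph → Set
Isomorphic A B = Σ (V → V) λ f → Σ (V → V) λ g →
  (∀ x → g (f x) ≡ x) × (∀ y → f (g y) ≡ y) × (∀ x y → A x y ≡ B (f x) (f y))

-- Control-1 between V_i and V_j forces the four arcs between them to form a directed
-- 4-cycle, which is determined by one bit: whether v_{i,1} → v_{j,1}.  The digraph is
-- therefore fixed by the six bits of the pairs i < j.  Swapping the two vertices of V_i
-- negates exactly the bits of the pairs containing i, so after such swaps the three bits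
-- of the pairs {1, j} are true; each of the eight digraphs left is mapped onto G1 or G2
-- by permuting the partite sets, possibly combined with a swap inside one of them.
module Submission where

open import Defs
open import Data.Bool using (Bool; true; false; not; _xor_; if_then_else_)
open import Data.Bool.Properties using (not-involutive; not-distribˡ-xor; xor-same)
  renaming (_≟_ to _≟ᴮ_)
open import Data.Fin using (Fin; suc; _<_; _≟_; opposite)
open import Data.Fin.Patterns using (0F; 1F; 2F; 3F)
open import Data.Fin.Permutation
  using (Permutation′; _⟨$⟩ʳ_; _⟨$⟩ˡ_; inverseˡ; inverseʳ; id; flip; transpose; _∘ₚ_)
open import Data.Fin.Properties using (<-cmp; <⇒≢; all?; opposite-involutive)
open import Data.Nat using (_+_; s≤s)
open import Data.Product using (_,_; proj₁; proj₂)
open import Data.Sum as Sum using (_⊎_; inj₁; inj₂)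
open import Function using (_∘_)
open import Relation.Binary.Definitions using (tri<; tri≈; tri>)
open import Relation.Binary.PropositionalEquality
  using (_≡_; _≢_; refl; sym; trans; cong; cong₂; module ≡-Reasoning)
open import Relation.Nullary.Decidable using (Dec; True; ⌊_⌋; map′; toWitness)
open import Relation.Unary using (Decidable)
open import Relation.Binary.Bundles using (Setoid)
import Relation.Binary.Reasoning.Setoid as SetoidReasoning
open import Level using (0ℓ)

Pattern : Set
Pattern = Fin 4 → Fin 4 → Bool

-- arc b k l says whether (i , k) → (j , l) in the 4-cycle between V_i and V_j whose bit is b.
arc : Bool → Fin 2 → Fin 2 → Bool
arc b 0F 0F = b
arc b 0F 1F = not b
arc b 1F 0F = not b
arc b 1F 1F = b

-- Only the entries β i j with i < j are read.
fourCycles : Pattern → Digraph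
fourCycles β (i , k) (j , l) with <-cmp i j
... | tri< _ _ _ = arc (β i j) k l
... | tri≈ _ _ _ = false
... | tri> _ _ _ = not (arc (β j i) l k)

infix 4 _≐_
_≐_ : Digraph → Digraph → Set
A ≐ B = ∀ x y → A x y ≡ B x y

fourCycles-cong : ∀ {β γ : Pattern} → (∀ {i j} → i < j → β i j ≡ γ i j) →
  fourCycles β ≐ fourCycles γ
fourCycles-cong β≡γ (i , k) (j , l) with <-cmp i j
... | tri< i<j _ _ = cong (λ b → arc b k l) (β≡γ i<j)
... | tri≈ _ _ _ = refl
... | tri> _ _ j<i = cong (λ b → not (arc b l k)) (β≡γ j<i)

-- Isomorphic A B unfolds to a Σ-type in which B occurs only applied to images f x, so
-- Agda cannot infer B from it; wrapping it in a record makes both digraphs inferable.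
record _≅_ (A B : Digraph) : Set where
  constructor mk≅
  field isomorphic : Isomorphic A B

open _≅_ using (isomorphic)

≐⇒≅ : ∀ {A B} → A ≐ B → A ≅ B
≐⇒≅ A≐B = mk≅ ((λ x → x) , (λ x → x) , (λ _ → refl) , (λ _ → refl) , A≐B)

≅-refl : ∀ {A} → A ≅ A
≅-refl = ≐⇒≅ (λ _ _ → refl)

≅-sym : ∀ {A B} → A ≅ B → B ≅ A
≅-sym {A} {B} (mk≅ (f , g , gf , fg , A≐Bf)) = mk≅ (g , f , fg , gf , B≐Ag)
  where
  B≐Ag : ∀ x y → B x y ≡ A (g x) (g y)
  B≐Ag x y = trans (sym (cong₂ B (fg x) (fg y))) (sym (A≐Bf (g x) (g y)))

≅-trans : ∀ {A B C} → A ≅ B → B ≅ C → A ≅ C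
≅-trans (mk≅ (f , g , gf , fg , A≐Bf)) (mk≅ (f′ , g′ , g′f′ , f′g′ , B≐Cf′)) = mk≅
  ( f′ ∘ f , g ∘ g′
  , (λ x → trans (cong g (g′f′ (f x))) (gf x))
  , (λ y → trans (cong f′ (fg (g′ y))) (f′g′ y))
  , (λ x y → trans (A≐Bf x y) (B≐Cf′ (f x) (f y))))

≅-setoid : Setoid 0ℓ 0ℓ
≅-setoid = record
  { Carrier = Digraph
  ; _≈_ = _≅_
  ; isEquivalence = record { refl = ≅-refl ; sym = ≅-sym ; trans = ≅-trans }
  }

swapIf : Bool → Fin 2 → Fin 2
swapIf c k = if c then opposite k else k

swapIf-involutive : ∀ c k → swapIf c (swapIf c k) ≡ k
swapIf-involutive true  k = opposite-involutive k
swapIf-involutive false k = refl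

relabel : Permutation′ 4 → (Fin 4 → Bool) → V → V
relabel π c (i , k) = π ⟨$⟩ʳ i , swapIf (c i) k

relabel⁻¹ : Permutation′ 4 → (Fin 4 → Bool) → V → V
relabel⁻¹ π c (j , l) = π ⟨$⟩ˡ j , swapIf (c (π ⟨$⟩ˡ j)) l

relabel⁻¹-relabel : ∀ π c x → relabel⁻¹ π c (relabel π c x) ≡ x
relabel⁻¹-relabel π c (i , k) = cong₂ _,_ (inverseˡ π) (begin
  swapIf (c (π ⟨$⟩ˡ (π ⟨$⟩ʳ i))) (swapIf (c i) k)
    ≡⟨ cong (λ j → swapIf (c j) (swapIf (c i) k)) (inverseˡ π) ⟩
  swapIf (c i) (swapIf (c i) k)
    ≡⟨ swapIf-involutive (c i) k ⟩
  k ∎)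
  where open ≡-Reasoning

relabel-relabel⁻¹ : ∀ π c y → relabel π c (relabel⁻¹ π c y) ≡ y
relabel-relabel⁻¹ π c (j , l) =
  cong₂ _,_ (inverseʳ π) (swapIf-involutive (c (π ⟨$⟩ˡ j)) l)

Relabels : Digraph → Digraph → Permutation′ 4 → (Fin 4 → Bool) → Set
Relabels A B π c = ∀ x y → A x y ≡ B (relabel π c x) (relabel π c y)

Relabels⇒≅ : ∀ {A B} π c → Relabels A B π c → A ≅ B
Relabels⇒≅ π c A≐Bf =
  mk≅ (relabel π c , relabel⁻¹ π c , relabel⁻¹-relabel π c , relabel-relabel⁻¹ π c , A≐Bf)

all-V? : ∀ {P : V → Set} → Decidable P → Dec (∀ x → P x)
all-V? P? = map′ (λ P∀ (i , k) → P∀ i k) (λ P∀ i k → P∀ (i , k))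
                 (all? λ i → all? λ k → P? (i , k))

relabels? : ∀ A B π c → Dec (Relabels A B π c)
relabels? A B π c =
  all-V? λ x → all-V? λ y → A x y ≟ᴮ B (relabel π c x) (relabel π c y)

≅-by : ∀ {A B} π c → {True (relabels? A B π c)} → A ≅ B
≅-by π c {ok} = Relabels⇒≅ π c (toWitness ok)

flipBits : (Fin 4 → Bool) → Pattern → Pattern
flipBits c β i j = c i xor (c j xor β i j)

arc-oppositeˡ : ∀ b k l → arc b (opposite k) l ≡ arc (not b) k l
arc-oppositeˡ b 0F 0F = refl
arc-oppositeˡ b 0F 1F = sym (not-involutive b)
arc-oppositeˡ b 1F 0F = sym (not-involutive b)
arc-oppositeˡ b 1F 1F = refl

arc-oppositeʳ : ∀ b k l → arc b k (opposite l) ≡ arc (not b) k l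
arc-oppositeʳ b 0F 0F = refl
arc-oppositeʳ b 0F 1F = sym (not-involutive b)
arc-oppositeʳ b 1F 0F = sym (not-involutive b)
arc-oppositeʳ b 1F 1F = refl

arc-swapIf : ∀ b c d k l → arc b (swapIf c k) (swapIf d l) ≡ arc (c xor (d xor b)) k l
arc-swapIf b false false k l = refl
arc-swapIf b true  false k l = arc-oppositeˡ b k l
arc-swapIf b false true  k l = arc-oppositeʳ b k l
arc-swapIf b true  true  k l =
  trans (arc-oppositeˡ b k (opposite l)) (arc-oppositeʳ (not b) k l)

fourCycles-swap : ∀ β c → Relabels (fourCycles (flipBits c β)) (fourCycles β) id c
fourCycles-swap β c (i , k) (j , l) with <-cmp i j
... | tri< _ _ _ = sym (arc-swapIf (β i j) (c i) (c j) k l)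
... | tri≈ _ _ _ = refl
... | tri> _ _ _ = sym (cong not (arc-swapIf (β j i) (c j) (c i) l k))

-- The left-hand side is what outInto A v j computes to.
exactlyOne : ∀ a b → (if a then 1 else 0) + ((if b then 1 else 0) + 0) ≡ 1 → b ≡ not a
exactlyOne true  false _ = refl
exactlyOne false true  _ = refl
exactlyOne true  true  ()
exactlyOne false false ()

outInto≡1 : ∀ {A} v j → outInto A v j ≡ 1 → A v (j , 1F) ≡ not (A v (j , 0F))
outInto≡1 {A} v j = exactlyOne (A v (j , 0F)) (A v (j , 1F))

bits : Digraph → Pattern
bits A i j = A (i , 0F) (j , 0F)

FourCycle : Digraph → Fin 4 → Fin 4 → Set
FourCycle A i j = ∀ k l → A (i , k) (j , l) ≡ arc (bits A i j) k l

module _ {A : Digraph} (tournament : IsMultipartiteTournament A) where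

  private
    converse : ∀ {i j} → i ≢ j → ∀ k l → A (i , k) (j , l) ≡ not (A (j , l) (i , k))
    converse i≢j k l = proj₂ tournament (_ , k) (_ , l) i≢j

  fourCycle : ∀ {i j} → i ≢ j →
    outInto A (i , 0F) j ≡ 1 → outInto A (i , 1F) j ≡ 1 → outInto A (j , 0F) i ≡ 1 →
    FourCycle A i j
  fourCycle {i} {j} i≢j out₀ out₁ in₀ = λ
    { 0F 0F → refl
    ; 0F 1F → outInto≡1 {A} (i , 0F) j out₀
    ; 1F 0F → i₁→j₀
    ; 1F 1F → trans (outInto≡1 {A} (i , 1F) j out₁)
                    (trans (cong not i₁→j₀) (not-involutive (bits A i j)))
    }
    where
    open ≡-Reasoning
    i₁→j₀ : A (i , 1F) (j , 0F) ≡ not (bits A i j)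
    i₁→j₀ = begin
      A (i , 1F) (j , 0F)              ≡⟨ converse i≢j 1F 0F ⟩
      not (A (j , 0F) (i , 1F))        ≡⟨ cong not (outInto≡1 {A} (j , 0F) i in₀) ⟩
      not (not (A (j , 0F) (i , 0F)))  ≡⟨ not-involutive _ ⟩
      A (j , 0F) (i , 0F)              ≡⟨ converse (i≢j ∘ sym) 0F 0F ⟩
      not (bits A i j)                 ∎

  controls1⇒fourCycle : ∀ {i j} → i ≢ j → Controls1 A i j ⊎ Controls1 A j i → FourCycle A i j
  controls1⇒fourCycle i≢j (inj₁ (_ , out₀ , out₁ , in₀ , _)) = fourCycle i≢j out₀ out₁ in₀
  controls1⇒fourCycle i≢j (inj₂ (_ , in₀ , _ , out₀ , out₁)) = fourCycle i≢j out₀ out₁ in₀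

  ≐fourCycles : (∀ {i j} → i ≢ j → FourCycle A i j) → A ≐ fourCycles (bits A)
  ≐fourCycles cycles (i , k) (j , l) with <-cmp i j
  ... | tri< i<j _ _ = cycles (<⇒≢ i<j) k l
  ... | tri≈ _ i≡j _ = proj₁ tournament (i , k) (j , l) i≡j
  ... | tri> _ _ j<i = trans (converse (<⇒≢ j<i ∘ sym) k l) (cong not (cycles (<⇒≢ j<i) l k))

normalising : Pattern → Fin 4 → Bool
normalising β 0F      = false
normalising β (suc j) = not (β 0F (suc j))

-- b₂₃ is the bit of the pair V₂, V₃, that is of the parts 1F and 2F.
normalForm : Bool → Bool → Bool → Pattern
normalForm b₂₃ b₂₄ b₃₄ 0F _  = true
normalForm b₂₃ b₂₄ b₃₄ 1F 2F = b₂₃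
normalForm b₂₃ b₂₄ b₃₄ 1F 3F = b₂₄
normalForm b₂₃ b₂₄ b₃₄ 2F 3F = b₃₄
normalForm b₂₃ b₂₄ b₃₄ _  _  = false

normalised : Pattern → Pattern
normalised β = normalForm (β′ 1F 2F) (β′ 1F 3F) (β′ 2F 3F)
  where
  β′ : Pattern
  β′ = flipBits (normalising β) β

not-xor-self : ∀ b → not b xor b ≡ true
not-xor-self b = trans (sym (not-distribˡ-xor b b)) (cong not (xor-same b))

fourCycles-normalise : ∀ β → fourCycles β ≅ fourCycles (normalised β)
fourCycles-normalise β = begin
  fourCycles β               ≈⟨ ≅-sym (Relabels⇒≅ id c (fourCycles-swap β c)) ⟩
  fourCycles (flipBits c β)  ≈⟨ ≐⇒≅ (fourCycles-cong agree) ⟩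
  fourCycles (normalised β)  ∎
  where
  open SetoidReasoning ≅-setoid
  c : Fin 4 → Bool
  c = normalising β
  agree : ∀ {i j} → i < j → flipBits c β i j ≡ normalised β i j
  agree {0F} {suc j} _ = not-xor-self (β 0F (suc j))
  agree {1F} {2F} _ = refl
  agree {1F} {3F} _ = refl
  agree {2F} {3F} _ = refl
  agree {0F}    {0F} ()
  agree {suc _} {0F} ()
  agree {1F} {1F} (s≤s ())
  agree {2F} {1F} (s≤s ())
  agree {2F} {2F} (s≤s (s≤s ()))
  agree {3F} {1F} (s≤s ())
  agree {3F} {2F} (s≤s (s≤s ()))
  agree {3F} {3F} (s≤s (s≤s (s≤s ())))

unswapped : Fin 4 → Bool
unswapped _ = false

swappedAt : Fin 4 → Fin 4 → Bool
swappedAt i j = ⌊ i ≟ j ⌋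

rotation : Permutation′ 4
rotation = transpose 1F 2F ∘ₚ transpose 1F 3F

normalForm-classification : ∀ b₂₃ b₂₄ b₃₄ →
  fourCycles (normalForm b₂₃ b₂₄ b₃₄) ≅ G1 ⊎ fourCycles (normalForm b₂₃ b₂₄ b₃₄) ≅ G2
normalForm-classification false false false = inj₂ (≅-by id unswapped)
normalForm-classification false false true  = inj₂ (≅-by (transpose 2F 3F) unswapped)
normalForm-classification false true  false = inj₁ (≅-by id (swappedAt 2F))
normalForm-classification false true  true  = inj₂ (≅-by rotation unswapped)
normalForm-classification true  false false = inj₂ (≅-by (transpose 1F 2F) unswapped)
normalForm-classification true  false true  = inj₁ (≅-by (transpose 2F 3F) (swappedAt 3F))
normalForm-classification true  true  false = inj₂ (≅-by (flip rotation) unswapped)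
normalForm-classification true  true  true  = inj₂ (≅-by (transpose 1F 3F) unswapped)

lemma3p2 : (A : Digraph) → IsMultipartiteTournament A → IsRegular A →
    (∀ (i j : Fin 4) → i ≢ j → Controls1 A i j ⊎ Controls1 A j i) →
    Isomorphic A G1 ⊎ Isomorphic A G2
lemma3p2 A tournament _ controls1 =
  Sum.map (isomorphic ∘ ≅-trans A≅N) (isomorphic ∘ ≅-trans A≅N) (normalForm-classification _ _ _)
  where
  open SetoidReasoning ≅-setoid
  A≅N : A ≅ fourCycles (normalised (bits A))
  A≅N = begin
    A                                ≈⟨ ≐⇒≅ (≐fourCycles tournament λ i≢j →
                                           controls1⇒fourCycle tournament i≢j (controls1 _ _ i≢j)) ⟩
    fourCycles (bits A)              ≈⟨ fourCycles-normalise (bits A) ⟩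
    fourCycles (normalised (bits A)) ∎
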